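{- For any nonnegative integers $d,i,m$ satisfying $d<i+m$ there exists a $(2i,d+1,2m,d)$-graph. Moreover, this graph can be taken to be a bipartite graph whose two parts have equal size.
   Context: For nonnegative integers $\alpha,a,\beta,b$, an $(\alpha,a,\beta,b)$-graph is a triangle-free graph with $\alpha+\beta$ vertices which has $\alpha$ vertices of degree $a$ and $\beta$ vertices of degree $b$ if $a\ne b$, and is $a$-regular if $a=b$. -}

module Defs where

open import Data.Bool using (Bool; true; false; not)
open import Data.Nat using (ℕ)
open import Data.Fin using (Fin)
open import Data.Sum using (_⊎_; inj₁; inj₂)
open import Data.List using (List; map; _++_; length; filterᵇ; allFin)
open import Data.Empty using (⊥)
open import Relation.Binary.PropositionalEquality using (_≡_)

record Graph (V : Set) : Set where
  field
    adj   : V → V → Bool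
    sym   : ∀ u v → adj u v ≡ adj v u
    irrefl : ∀ v → adj v v ≡ false

Vtx : ℕ → ℕ → Set
Vtx α β = Fin α ⊎ Fin β

allVtx : (α β : ℕ) → List (Vtx α β)
allVtx α β = map inj₁ (allFin α) ++ map inj₂ (allFin β)

degree : {α β : ℕ} → Graph (Vtx α β) → Vtx α β → ℕ
degree {α} {β} G v = length (filterᵇ (Graph.adj G v) (allVtx α β))

TriangleFree : {V : Set} → Graph V → Set
TriangleFree G = ∀ u v w → adj u v ≡ true → adj v w ≡ true → adj u w ≡ true → ⊥
  where open Graph G

-- An (α,a,β,b)-graph: a triangle-free graph on α+β vertices where α vertices
-- (the inj₁ ones) have degree a and β vertices (the inj₂ ones) have degree b.
-- (When a ≡ b this is exactly a-regularity.)  Any graph with α vertices of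
-- degree a and β of degree b is isomorphic to one labelled this way.
record IsGraph₄ (α a β b : ℕ) (G : Graph (Vtx α β)) : Set where
  field
    triangleFree : TriangleFree G
    degLeft      : ∀ (x : Fin α) → degree G (inj₁ x) ≡ a
    degRight     : ∀ (y : Fin β) → degree G (inj₂ y) ≡ b

record BalancedBipartite {α β : ℕ} (G : Graph (Vtx α β)) : Set where
  field
    colour  : Vtx α β → Bool
    proper  : ∀ u v → Graph.adj G u v ≡ true → colour u ≡ not (colour v)
    balanced : length (filterᵇ colour (allVtx α β))
             ≡ length (filterᵇ (λ v → not (colour v)) (allVtx α β))

-- Put n = i + m and take a top and a bottom copy of {0, …, n − 1}.  Join top a to
-- bottom b when b − a ∈ {1, …, d} modulo n, and also when a = b < i.  Since d < n the
-- cyclic window has exactly d elements, so the edges of the first kind form a d-regular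
-- bipartite graph, and the partial matching raises the degree of exactly i top and i bottom
-- vertices to d + 1.  The graph is bipartite with equal sides, hence triangle-free.
-- Modular arithmetic is avoided by lifting b to both b and n + b: the edge condition says
-- that one lift lies in the interval (a, a + d] of [0, 2n), so row and column degrees
-- become counts of an interval of length d.

module Submission where

open import Defs
open import Data.Nat using (ℕ; _<_; _+_; _*_; suc)
open import Data.Product using (Σ; _×_)

open import Data.Bool using (Bool; true; false; not; _∧_; _∨_; T; if_then_else_)
open import Data.Bool.Properties using (∧-comm; ∧-identityʳ; not-involutive; not-¬; T-≡; T-∧; T-∨)
open import Data.Empty using (⊥)
open import Data.Fin using (Fin; toℕ) renaming (zero to fzero; suc to fsuc)
open import Data.Fin.Properties using (toℕ<n)
open import Data.List using (List; tabulate; map; _++_; length; filterᵇ; allFin)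
open import Data.List.Properties using (filter-++; length-++; map-tabulate)
open import Data.Nat using (zero; _≤_; _∸_; _<ᵇ_; _≡ᵇ_; s≤s; z<s; s<s)
open import Data.Nat.Properties
open import Algebra.Properties.CommutativeSemigroup +-commutativeSemigroup using (interchange; x∙yz≈y∙xz)
open import Data.Product using (_,_; proj₁; proj₂)
open import Data.Sum using (inj₁; inj₂)
open import Function using (_∘_; Equivalence)
open import Relation.Binary.PropositionalEquality
open import Relation.Nullary using (contradiction; T?)

<ᵇ≡true⇒< : ∀ {m n} → (m <ᵇ n) ≡ true → m < n
<ᵇ≡true⇒< {m} {n} eq = <ᵇ⇒< m n (Equivalence.from T-≡ eq)

m+n≮ᵇm : ∀ m n → (m + n <ᵇ m) ≡ false
m+n≮ᵇm zero    n = refl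
m+n≮ᵇm (suc m) n = m+n≮ᵇm m n

+-<ᵇ-cancelˡ : ∀ n x y → (n + x <ᵇ n + y) ≡ (x <ᵇ y)
+-<ᵇ-cancelˡ zero    x y = refl
+-<ᵇ-cancelˡ (suc n) x y = +-<ᵇ-cancelˡ n x y

<ᵇ-suc : ∀ x y → (y <ᵇ suc x) ≡ not (x <ᵇ y)
<ᵇ-suc zero    zero    = refl
<ᵇ-suc zero    (suc y) = refl
<ᵇ-suc (suc x) zero    = refl
<ᵇ-suc (suc x) (suc y) = <ᵇ-suc x y

≡ᵇ-comm : ∀ a b → (a ≡ᵇ b) ≡ (b ≡ᵇ a)
≡ᵇ-comm zero    zero    = refl
≡ᵇ-comm zero    (suc b) = refl
≡ᵇ-comm (suc a) zero    = refl
≡ᵇ-comm (suc a) (suc b) = ≡ᵇ-comm a b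

indicator : Bool → ℕ
indicator true  = 1
indicator false = 0

count : ℕ → (ℕ → Bool) → ℕ
count zero    p = 0
count (suc k) p = indicator (p 0) + count k (p ∘ suc)

count-cong : ∀ k {p q : ℕ → Bool} → (∀ {j} → j < k → p j ≡ q j) → count k p ≡ count k q
count-cong zero    eq = refl
count-cong (suc k) eq = cong₂ _+_ (cong indicator (eq z<s)) (count-cong k (eq ∘ s<s))

count-false : ∀ k → count k (λ _ → false) ≡ 0
count-false zero    = refl
count-false (suc k) = count-false k

count-+ : ∀ k l (p : ℕ → Bool) → count (k + l) p ≡ count k p + count l (λ j → p (k + j))
count-+ zero    l p = refl
count-+ (suc k) l p = trans (cong (indicator (p 0) +_) (count-+ k l (p ∘ suc)))
                            (sym (+-assoc (indicator (p 0)) _ _))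

count-∨ : ∀ k (p q : ℕ → Bool) → (∀ j → T (p j) → T (q j) → ⊥) →
          count k (λ j → p j ∨ q j) ≡ count k p + count k q
count-∨ zero    p q disjoint = refl
count-∨ (suc k) p q disjoint with p 0 | q 0 | disjoint 0
... | true  | true  | disjoint₀ = contradiction _ (disjoint₀ _)
... | true  | false | _ = cong suc (count-∨ k (p ∘ suc) (q ∘ suc) (disjoint ∘ suc))
... | false | false | _ = count-∨ k (p ∘ suc) (q ∘ suc) (disjoint ∘ suc)
... | false | true  | _ = trans (cong suc (count-∨ k (p ∘ suc) (q ∘ suc) (disjoint ∘ suc)))
                                (sym (+-suc (count k (p ∘ suc)) _))

count-single : ∀ k a (p : ℕ → Bool) → a < k → count k (λ j → (a ≡ᵇ j) ∧ p j) ≡ indicator (p a)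
count-single (suc k) zero    p _         = trans (cong (indicator (p 0) +_) (count-false k))
                                                 (+-identityʳ _)
count-single (suc k) (suc a) p (s<s a<k) = count-single k a (p ∘ suc) a<k

count-<ᵇ : ∀ k hi → hi ≤ k → count k (_<ᵇ hi) ≡ hi
count-<ᵇ k       zero     _         = count-false k
count-<ᵇ (suc k) (suc hi) (s≤s hi≤k) = cong suc (count-<ᵇ k hi hi≤k)

between : ℕ → ℕ → ℕ → Bool
between lo hi j = (j <ᵇ hi) ∧ not (j <ᵇ lo)

count-between : ∀ k lo hi → hi ≤ k → count k (between lo hi) ≡ hi ∸ lo
count-between k       zero     hi       hi≤k      =
  trans (count-cong k (λ {j} _ → ∧-identityʳ (j <ᵇ hi))) (count-<ᵇ k hi hi≤k)
count-between k       (suc lo) zero     _         = count-false k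
count-between (suc k) (suc lo) (suc hi) (s≤s hi≤k) = count-between k lo hi hi≤k

T-between : ∀ {lo hi j} → T (between lo hi j) → lo ≤ j × j < hi
T-between {lo} {hi} {j} t with j <ᵇ hi in lt | j <ᵇ lo in ge
... | true | false = ≮⇒≥ (λ j<lo → subst T ge (<⇒<ᵇ j<lo)) , <ᵇ≡true⇒< lt

between-shift : ∀ n lo hi j → between (n + lo) (n + hi) (n + j) ≡ between lo hi j
between-shift n lo hi j = cong₂ (λ x y → x ∧ not y) (+-<ᵇ-cancelˡ n j hi) (+-<ᵇ-cancelˡ n j lo)

module Window (d : ℕ) where

  follows : ℕ → ℕ → Bool
  follows a c = between (suc a) (d + suc a) c

  T-follows : ∀ {a c} → T (follows a c) → a < c × c < d + suc a
  T-follows = T-between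

  follows-shift : ∀ n a c → follows (n + a) (n + c) ≡ follows a c
  follows-shift n a c = trans (cong₂ (λ lo hi → between lo hi (n + c)) (sym (+-suc n a)) hi-shift)
                           (between-shift n (suc a) (d + suc a) c)
    where
      hi-shift : d + suc (n + a) ≡ n + (d + suc a)
      hi-shift = trans (cong (d +_) (sym (+-suc n a))) (x∙yz≈y∙xz d n (suc a))

  count-successors : ∀ k a → d + suc a ≤ k → count k (follows a) ≡ d
  count-successors k a bound = trans (count-between k (suc a) (d + suc a) bound) (m+n∸n≡m d (suc a))

  follows-as-between : ∀ a e → follows a (d + e) ≡ between e (d + e) a
  follows-as-between a e = begin
      (d + e <ᵇ d + suc a) ∧ not (d + e <ᵇ suc a)
    ≡⟨ cong₂ (λ x y → x ∧ not y) (trans (+-<ᵇ-cancelˡ d e (suc a)) (<ᵇ-suc a e)) (<ᵇ-suc a (d + e)) ⟩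
      not (a <ᵇ e) ∧ not (not (a <ᵇ d + e))
    ≡⟨ cong (not (a <ᵇ e) ∧_) (not-involutive (a <ᵇ d + e)) ⟩
      not (a <ᵇ e) ∧ (a <ᵇ d + e)
    ≡⟨ ∧-comm (not (a <ᵇ e)) (a <ᵇ d + e) ⟩
      (a <ᵇ d + e) ∧ not (a <ᵇ e)
    ∎ where open ≡-Reasoning

  count-predecessors : ∀ k c → d ≤ c → c ≤ k → count k (λ a → follows a c) ≡ d
  count-predecessors k c d≤c c≤k = begin
      count k (λ a → follows a c)
    ≡⟨ cong (λ c → count k (λ a → follows a c)) (sym d+e≡c) ⟩
      count k (λ a → follows a (d + e))
    ≡⟨ count-cong k (λ {a} _ → follows-as-between a e) ⟩
      count k (between e (d + e))
    ≡⟨ count-between k e (d + e) (subst (_≤ k) (sym d+e≡c) c≤k) ⟩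
      d + e ∸ e
    ≡⟨ m+n∸n≡m d e ⟩
      d
    ∎ where
      open ≡-Reasoning
      e : ℕ
      e = c ∸ d
      d+e≡c : d + e ≡ c
      d+e≡c = m+[n∸m]≡n d≤c

module Biadjacency (d i n : ℕ) (d<n : d < n) where
  open Window d

  matched : ℕ → ℕ → Bool
  matched a b = (a ≡ᵇ b) ∧ (b <ᵇ i)

  edge : ℕ → ℕ → Bool
  edge a b = (matched a b ∨ follows a b) ∨ follows a (n + b)

  T-matched : ∀ {a b} → T (matched a b) → a ≡ b
  T-matched {a} {b} t = ≡ᵇ⇒≡ a b (proj₁ (Equivalence.to T-∧ t))

  matched-follows-disjoint : ∀ a b → T (matched a b) → T (follows a b) → ⊥
  matched-follows-disjoint a b m nr = <-irrefl (T-matched m) (proj₁ (T-follows nr))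

  wrapped-follows-impossible : ∀ {a b} → a ≤ b → T (follows a (n + b)) → ⊥
  wrapped-follows-impossible {a} {b} a≤b nr = <⇒≱ (proj₂ (T-follows nr)) window-end≤
    where
      window-end≤ : d + suc a ≤ n + b
      window-end≤ = subst (_≤ n + b) (sym (+-suc d a)) (+-mono-≤ d<n a≤b)

  unwrapped-edge⇒≤ : ∀ {a b} → T (matched a b ∨ follows a b) → a ≤ b
  unwrapped-edge⇒≤ t with Equivalence.to T-∨ t
  ... | inj₁ m  = ≤-reflexive (T-matched m)
  ... | inj₂ nr = <⇒≤ (proj₁ (T-follows nr))

  count-edge : ∀ k (f g : ℕ → ℕ) →
    count k (λ j → edge (f j) (g j))
      ≡ count k (λ j → matched (f j) (g j)) + count k (λ j → follows (f j) (g j))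
        + count k (λ j → follows (f j) (n + g j))
  count-edge k f g =
    trans (count-∨ k _ _ (λ _ → wrapped-follows-impossible ∘ unwrapped-edge⇒≤))
          (cong (_+ _) (count-∨ k _ _ (λ j → matched-follows-disjoint (f j) (g j))))

  row-degree : ∀ a → a < n → count n (edge a) ≡ indicator (a <ᵇ i) + d
  row-degree a a<n = begin
      count n (edge a)
    ≡⟨ count-edge n (λ _ → a) (λ b → b) ⟩
      count n (matched a) + count n (follows a) + count n (λ b → follows a (n + b))
    ≡⟨ +-assoc (count n (matched a)) _ _ ⟩
      count n (matched a) + (count n (follows a) + count n (λ b → follows a (n + b)))
    ≡⟨ cong₂ _+_ (count-single n a (_<ᵇ i) a<n) (sym (count-+ n n (follows a))) ⟩
      indicator (a <ᵇ i) + count (n + n) (follows a)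
    ≡⟨ cong (indicator (a <ᵇ i) +_) (count-successors (n + n) a (+-mono-≤ (<⇒≤ d<n) a<n)) ⟩
      indicator (a <ᵇ i) + d
    ∎ where open ≡-Reasoning

  column-degree : ∀ b → b < n → count n (λ a → edge a b) ≡ indicator (b <ᵇ i) + d
  column-degree b b<n = begin
      count n (λ a → edge a b)
    ≡⟨ count-edge n (λ a → a) (λ _ → b) ⟩
      count n (λ a → matched a b) + count n (λ a → follows a b) + count n wrapped
    ≡⟨ +-assoc (count n (λ a → matched a b)) _ _ ⟩
      count n (λ a → matched a b) + (count n (λ a → follows a b) + count n wrapped)
    ≡⟨ cong₂ _+_ matched-column (cong (_+ count n wrapped) lifted) ⟩
      indicator (b <ᵇ i) + (count n (λ a → wrapped (n + a)) + count n wrapped)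
    ≡⟨ cong (indicator (b <ᵇ i) +_) (+-comm (count n (λ a → wrapped (n + a))) _) ⟩
      indicator (b <ᵇ i) + (count n wrapped + count n (λ a → wrapped (n + a)))
    ≡⟨ cong (indicator (b <ᵇ i) +_) (sym (count-+ n n wrapped)) ⟩
      indicator (b <ᵇ i) + count (n + n) wrapped
    ≡⟨ cong (indicator (b <ᵇ i) +_) (count-predecessors (n + n) (n + b) d≤n+b (+-monoʳ-≤ n (<⇒≤ b<n))) ⟩
      indicator (b <ᵇ i) + d
    ∎ where
      open ≡-Reasoning
      wrapped : ℕ → Bool
      wrapped a = follows a (n + b)
      matched-column : count n (λ a → matched a b) ≡ indicator (b <ᵇ i)
      matched-column = trans (count-cong n (λ {a} _ → cong (_∧ (b <ᵇ i)) (≡ᵇ-comm a b)))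
                             (count-single n b (λ _ → b <ᵇ i) b<n)
      lifted : count n (λ a → follows a b) ≡ count n (λ a → wrapped (n + a))
      lifted = count-cong n (λ {a} _ → sym (follows-shift n a b))
      d≤n+b : d ≤ n + b
      d≤n+b = ≤-trans (<⇒≤ d<n) (m≤m+n n b)

length-filterᵇ-tabulate : ∀ {A : Set} k (p : A → Bool) (f : Fin k → A) (Q : ℕ → Bool) →
  (∀ x → p (f x) ≡ Q (toℕ x)) → length (filterᵇ p (tabulate f)) ≡ count k Q
length-filterᵇ-tabulate zero    p f Q eq = refl
length-filterᵇ-tabulate (suc k) p f Q eq with p (f fzero) | eq fzero
... | true  | e rewrite sym e = cong suc (length-filterᵇ-tabulate k p (f ∘ fsuc) (Q ∘ suc) (eq ∘ fsuc))
... | false | e rewrite sym e = length-filterᵇ-tabulate k p (f ∘ fsuc) (Q ∘ suc) (eq ∘ fsuc)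

foldHalf : ℕ → ℕ → ℕ
foldHalf k j = if j <ᵇ k then j else j ∸ k

foldHalf-< : ∀ k j → j < 2 * k → foldHalf k j < k
foldHalf-< k j j<2k with j <ᵇ k in lt
... | true  = <ᵇ≡true⇒< lt
... | false = +-cancelˡ-< k (j ∸ k) k (subst (_< k + k) (sym (m+[n∸m]≡n k≤j)) j<k+k)
  where
    k≤j : k ≤ j
    k≤j = ≮⇒≥ (λ j<k → subst T lt (<⇒<ᵇ j<k))
    j<k+k : j < k + k
    j<k+k = subst (j <_) (cong (k +_) (+-identityʳ k)) j<2k

count-foldHalf : ∀ k (G : Bool → ℕ → Bool) →
  count (2 * k) (λ j → G (j <ᵇ k) (foldHalf k j)) ≡ count k (G true) + count k (G false)
count-foldHalf k G = begin
    count (2 * k) H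
  ≡⟨ cong (λ l → count (k + l) H) (+-identityʳ k) ⟩
    count (k + k) H
  ≡⟨ count-+ k k H ⟩
    count k H + count k (λ j → H (k + j))
  ≡⟨ cong₂ _+_ (count-cong k lower) (count-cong k (λ {j} _ → upper j)) ⟩
    count k (G true) + count k (G false)
  ∎ where
    open ≡-Reasoning
    H : ℕ → Bool
    H j = G (j <ᵇ k) (foldHalf k j)
    lower : ∀ {j} → j < k → H j ≡ G true j
    lower j<k rewrite Equivalence.to T-≡ (<⇒<ᵇ j<k) = refl
    upper : ∀ j → H (k + j) ≡ G false j
    upper j rewrite m+n≮ᵇm k j | m+n∸m≡n k j = refl

-- With true for the top side, inj₁ x is top x or bottom x − i, and inj₂ y is top i + y or
-- bottom i + (y − m); thus the inj₁ vertices are exactly those of index below i.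
module Labelling (i m : ℕ) where

  side : Vtx (2 * i) (2 * m) → Bool
  side (inj₁ x) = toℕ x <ᵇ i
  side (inj₂ y) = toℕ y <ᵇ m

  index : Vtx (2 * i) (2 * m) → ℕ
  index (inj₁ x) = foldHalf i (toℕ x)
  index (inj₂ y) = i + foldHalf m (toℕ y)

  count-allVtx : (F : Bool → ℕ → Bool) →
    length (filterᵇ (λ v → F (side v) (index v)) (allVtx (2 * i) (2 * m)))
      ≡ count (i + m) (F true) + count (i + m) (F false)
  count-allVtx F = begin
      length (filterᵇ q (left ++ right))
    ≡⟨ cong length (filter-++ (T? ∘ q) left right) ⟩
      length (filterᵇ q left ++ filterᵇ q right)
    ≡⟨ length-++ (filterᵇ q left) ⟩
      length (filterᵇ q left) + length (filterᵇ q right)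
    ≡⟨ cong₂ _+_ (count-half inj₁ (λ j → F (j <ᵇ i) (foldHalf i j)) (λ _ → refl))
                 (count-half inj₂ (λ j → F (j <ᵇ m) (i + foldHalf m j)) (λ _ → refl)) ⟩
      count (2 * i) (λ j → F (j <ᵇ i) (foldHalf i j)) + count (2 * m) (λ j → F (j <ᵇ m) (i + foldHalf m j))
    ≡⟨ cong₂ _+_ (count-foldHalf i F) (count-foldHalf m (λ s t → F s (i + t))) ⟩
      (count i (F true) + count i (F false))
        + (count m (λ t → F true (i + t)) + count m (λ t → F false (i + t)))
    ≡⟨ interchange (count i (F true)) _ _ _ ⟩
      (count i (F true) + count m (λ t → F true (i + t)))
        + (count i (F false) + count m (λ t → F false (i + t)))
    ≡⟨ sym (cong₂ _+_ (count-+ i m (F true)) (count-+ i m (F false))) ⟩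
      count (i + m) (F true) + count (i + m) (F false)
    ∎ where
      open ≡-Reasoning
      q : Vtx (2 * i) (2 * m) → Bool
      q v = F (side v) (index v)
      left right : List (Vtx (2 * i) (2 * m))
      left  = map inj₁ (allFin (2 * i))
      right = map inj₂ (allFin (2 * m))
      count-half : ∀ {k} (f : Fin k → Vtx (2 * i) (2 * m)) (Q : ℕ → Bool) →
        (∀ x → q (f x) ≡ Q (toℕ x)) → length (filterᵇ q (map f (allFin k))) ≡ count k Q
      count-half {k} f Q eq = trans (cong (length ∘ filterᵇ q) (map-tabulate (λ x → x) f))
                                    (length-filterᵇ-tabulate k q f Q eq)

twoColourable⇒triangleFree : ∀ {V : Set} (G : Graph V) (colour : V → Bool) →
  (∀ u v → Graph.adj G u v ≡ true → colour u ≡ not (colour v)) → TriangleFree G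
twoColourable⇒triangleFree G colour proper u v w uv vw uw = not-¬ same (proper u w uw)
  where
    same : colour u ≡ colour w
    same = trans (proper u v uv) (trans (cong not (proper v w vw)) (not-involutive (colour w)))

module BipartiteDouble {V : Set} (side : V → Bool) (index : V → ℕ) (R : ℕ → ℕ → Bool) where

  adj : Bool → ℕ → Bool → ℕ → Bool
  adj true  a false b = R a b
  adj false b true  a = R a b
  adj _     _ _     _ = false

  adj-sym : ∀ s a t b → adj s a t b ≡ adj t b s a
  adj-sym true  a true  b = refl
  adj-sym true  a false b = refl
  adj-sym false a true  b = refl
  adj-sym false a false b = refl

  adj-irrefl : ∀ s a → adj s a s a ≡ false
  adj-irrefl true  a = refl
  adj-irrefl false a = refl

  adj-proper : ∀ s a t b → adj s a t b ≡ true → s ≡ not t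
  adj-proper true  a false b _ = refl
  adj-proper false a true  b _ = refl

  graph : Graph V
  graph = record
    { adj    = λ u v → adj (side u) (index u) (side v) (index v)
    ; sym    = λ u v → adj-sym (side u) (index u) (side v) (index v)
    ; irrefl = λ v → adj-irrefl (side v) (index v)
    }

  proper : ∀ u v → Graph.adj graph u v ≡ true → side u ≡ not (side v)
  proper u v = adj-proper (side u) (index u) (side v) (index v)

module Construction (d i m : ℕ) (d<i+m : d < i + m) where
  open Biadjacency d i (i + m) d<i+m
  open Labelling i m
  open BipartiteDouble side index edge public

  neighbours : ∀ s a → a < i + m →
    count (i + m) (adj s a true) + count (i + m) (adj s a false) ≡ indicator (a <ᵇ i) + d
  neighbours true  a a<n =
    trans (cong (_+ count (i + m) (edge a)) (count-false (i + m))) (row-degree a a<n)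
  neighbours false a a<n =
    trans (trans (cong (count (i + m) (λ b → edge b a) +_) (count-false (i + m))) (+-identityʳ _))
          (column-degree a a<n)

  degree-graph : ∀ v → index v < i + m → degree graph v ≡ indicator (index v <ᵇ i) + d
  degree-graph v bound =
    trans (count-allVtx (adj (side v) (index v))) (neighbours (side v) (index v) bound)

  degree-inj₁ : ∀ x → degree graph (inj₁ x) ≡ suc d
  degree-inj₁ x = trans (degree-graph (inj₁ x) (≤-trans index<i (m≤m+n i m)))
                        (cong (λ b → indicator b + d) (Equivalence.to T-≡ (<⇒<ᵇ index<i)))
    where
      index<i : index (inj₁ x) < i
      index<i = foldHalf-< i (toℕ x) (toℕ<n x)

  degree-inj₂ : ∀ y → degree graph (inj₂ y) ≡ d
  degree-inj₂ y = trans (degree-graph (inj₂ y) (+-monoʳ-< i (foldHalf-< m (toℕ y) (toℕ<n y))))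
                        (cong (λ b → indicator b + d) (m+n≮ᵇm i _))

  isGraph₄ : IsGraph₄ (2 * i) (suc d) (2 * m) d graph
  isGraph₄ = record
    { triangleFree = twoColourable⇒triangleFree graph side proper
    ; degLeft      = degree-inj₁
    ; degRight     = degree-inj₂
    }

  balancedBipartite : BalancedBipartite graph
  balancedBipartite = record
    { colour   = side
    ; proper   = proper
    ; balanced = trans (count-allVtx (λ s _ → s))
                       (trans (+-comm (count (i + m) (λ _ → true)) _)
                              (sym (count-allVtx (λ s _ → not s))))
    }

lemma5p1 : (d i m : ℕ) → d < i + m →
    Σ (Graph (Vtx (2 * i) (2 * m))) (λ G →
      IsGraph₄ (2 * i) (suc d) (2 * m) d G × BalancedBipartite G)
lemma5p1 d i m d<i+m = graph , isGraph₄ , balancedBipartite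
  where open Construction d i m d<i+m
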